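{- Let $\ell\ge1$, $V=\{0,1\}^{\ell^2}$, and let $\varphi$ be the modified CFLS coloring of the complete graph on $V$ defined in the context. There do not exist distinct $a,b,c,d,e\in V$ and colors $\alpha,\beta$ with $\varphi(ab)=\varphi(bc)=\varphi(de)=\alpha$ and $\varphi(cd)=\varphi(ae)=\beta$.
   Context: Let $\ell$ be a positive integer and $V=\{0,1\}^{\ell^2}$. For $v\in V$ write $v=(v^{(1)},\dots,v^{(\ell)})$ with each block $v^{(k)}\in\{0,1\}^{\ell}$. For distinct $x,y\in V$ let $\varphi_1(x,y)=\big((i,\{x^{(i)},y^{(i)}\}),i_1,\dots,i_\ell\big)$, where $i$ is the least index with $x^{(i)}\ne y^{(i)}$, and $i_k=0$ if $x^{(k)}=y^{(k)}$, otherwise $i_k$ is the least position at which the bits of $x^{(k)}$ and $y^{(k)}$ differ. Order $V$ and $\{0,1\}^\ell$ by reading strings as binary integers (first bit most significant). For $x<y$ let $\varphi_2(x,y)=\varphi_2(y,x)=(\delta_1,\dots,\delta_\ell)$ with $\delta_k=-1$ if $x^{(k)}>y^{(k)}$ and $\delta_k=+1$ if $x^{(k)}\le y^{(k)}$. The modified CFLS coloring is $\varphi(xy)=(\varphi_1(x,y),\varphi_2(x,y))$. -}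

module Defs where

open import Data.Bool using (Bool; true; false; if_then_else_)
open import Data.Bool.Properties using () renaming (_≟_ to _≟ᵇ_)
open import Data.Nat using (ℕ; zero; suc; _+_; _*_; _^_; _<ᵇ_)
open import Data.Product using (_×_; _,_)
open import Data.Sign using (Sign)
open import Data.Vec using (Vec; []; _∷_; concat; zipWith)
open import Data.Vec.Properties using (≡-dec)
open import Relation.Nullary using (yes; no)
open import Relation.Binary.Definitions using (DecidableEquality)

Bits : ℕ → Set
Bits ℓ = Vec Bool ℓ

-- V = {0,1}^{ℓ²}, written as ℓ blocks of length ℓ: v = (v^(1), …, v^(ℓ)).
V : ℕ → Set
V ℓ = Vec (Bits ℓ) ℓ

value : ∀ {n} → Bits n → ℕ
value []            = 0
value {suc n} (b ∷ bs) = (if b then 2 ^ n else 0) + value bs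

_<bits_ : ∀ {n} → Bits n → Bits n → Bool
x <bits y = value x <ᵇ value y

_<V_ : ∀ {ℓ} → V ℓ → V ℓ → Bool
x <V y = value (concat x) <ᵇ value (concat y)

-- firstDiff x y = 0 if x = y, otherwise the least (1-based) index at which x and y differ.
firstDiff : ∀ {A : Set} → DecidableEquality A → ∀ {n} → Vec A n → Vec A n → ℕ
firstDiff _≟_ [] [] = 0
firstDiff _≟_ (a ∷ as) (b ∷ bs) with a ≟ b
... | no  _ = 1
... | yes _ with firstDiff _≟_ as bs
...   | zero  = 0
...   | suc k = suc (suc k)

-- The unordered pair {p, q} ⊆ {0,1}^ℓ, encoded canonically as (smaller, larger).
unorderedPair : ∀ {ℓ} → Bits ℓ → Bits ℓ → Bits ℓ × Bits ℓ
unorderedPair p q = if p <bits q then (p , q) else (q , p)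

lookup1 : ∀ {A : Set} {n} → Vec A n → ℕ → A → A
lookup1 [] _ d = d
lookup1 (a ∷ as) zero d = a
lookup1 (a ∷ as) (suc zero) d = a
lookup1 (a ∷ as) (suc (suc k)) d = lookup1 as (suc k) d

-- First component of the color: ((i , {x^(i), y^(i)}) , i_1, …, i_ℓ).
Color₁ : ℕ → Set
Color₁ ℓ = (ℕ × (Bits ℓ × Bits ℓ)) × Vec ℕ ℓ

φ₁ : ∀ {ℓ} → V ℓ → V ℓ → Color₁ ℓ
φ₁ {ℓ} x y =
  let i = firstDiff (≡-dec _≟ᵇ_) x y in
  ( (i , unorderedPair (lookup1 x i (Data.Vec.replicate ℓ false))
                       (lookup1 y i (Data.Vec.replicate ℓ false)))
  , zipWith (firstDiff _≟ᵇ_) x y )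

δ : ∀ {ℓ} → V ℓ → V ℓ → Vec Sign ℓ
δ x y = zipWith (λ xk yk → if yk <bits xk then Sign.- else Sign.+) x y

φ₂ : ∀ {ℓ} → V ℓ → V ℓ → Vec Sign ℓ
φ₂ x y = if x <V y then δ x y else δ y x

Color : ℕ → Set
Color ℓ = Color₁ ℓ × Vec Sign ℓ

-- The modified CFLS coloring φ(xy) = (φ₁(x,y), φ₂(x,y)) (used on distinct x, y).
φ : ∀ {ℓ} → V ℓ → V ℓ → Color ℓ
φ x y = (φ₁ x y , φ₂ x y)

module Submission where

-- Let i be the first block in which a and b differ and write X
-- for the i-th block of a vertex x.  The first component of the color records
-- the index of the first differing block together with the unordered pair of
-- blocks there, and the vector of first differing bit positions per block.
--   * φ(bc) = φ(ab): the pair {B,C} equals {A,B}; as A ≠ B this forces C = A.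
--   * φ(de) = φ(ab): the first differing block of d,e is i and {D,E} = {A,B}.
--   * φ(cd) = φ(ae): in block i, the first differing bit of (C,D) equals that
--     of (A,E); with C = A the block A is "equidistant" from D and E.
-- Since {D,E} = {A,B}, one of D, E equals A, whose distance to A is 0, so the
-- other one is equal to A as well, giving A = B: a contradiction.

open import Defs
open import Data.Nat using (ℕ; _≥_; zero; suc)
open import Data.Product using (_×_; Σ-syntax; _,_; proj₁; proj₂)
open import Data.Product.Properties using (,-injectiveˡ; ,-injectiveʳ)
open import Data.Sum using (_⊎_; inj₁; inj₂)
open import Data.Bool using (true; false)
open import Data.Bool.Properties using () renaming (_≟_ to _≟ᵇ_)
open import Data.Vec using (Vec; []; _∷_; zipWith; replicate)
open import Data.Vec.Properties using (≡-dec)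
open import Data.Empty using (⊥-elim)
open import Relation.Nullary using (¬_; yes; no)
open import Relation.Binary.Definitions using (DecidableEquality)
open import Relation.Binary.PropositionalEquality
  using (_≡_; _≢_; refl; sym; trans; cong; subst; module ≡-Reasoning)

module _ {A : Set} (_≟_ : DecidableEquality A) where

  firstDiff-refl : ∀ {n} (x : Vec A n) → firstDiff _≟_ x x ≡ 0
  firstDiff-refl [] = refl
  firstDiff-refl (a ∷ as) with a ≟ a
  ... | no a≢a = ⊥-elim (a≢a refl)
  ... | yes _ with firstDiff _≟_ as as | firstDiff-refl as
  ...   | zero | _ = refl

  firstDiff≡0⇒≡ : ∀ {n} (x y : Vec A n) → firstDiff _≟_ x y ≡ 0 → x ≡ y
  firstDiff≡0⇒≡ [] [] _ = refl
  firstDiff≡0⇒≡ (a ∷ as) (b ∷ bs) h with a ≟ b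
  firstDiff≡0⇒≡ (a ∷ as) (b ∷ bs) () | no _
  ... | yes refl with firstDiff _≟_ as bs in eq
  ...   | zero = cong (a ∷_) (firstDiff≡0⇒≡ as bs eq)

  lookup1-firstDiff : ∀ {n} (x y : Vec A n) (d : A) → x ≢ y →
    lookup1 x (firstDiff _≟_ x y) d ≢ lookup1 y (firstDiff _≟_ x y) d
  lookup1-firstDiff [] [] d x≢y = ⊥-elim (x≢y refl)
  lookup1-firstDiff (a ∷ as) (b ∷ bs) d x≢y with a ≟ b
  ... | no a≢b = a≢b
  ... | yes refl with firstDiff _≟_ as bs in eq
  ...   | zero = ⊥-elim (x≢y (cong (a ∷_) (firstDiff≡0⇒≡ as bs eq)))
  ...   | suc k = subst (λ m → lookup1 as m d ≢ lookup1 bs m d) eq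
                    (lookup1-firstDiff as bs d (λ p → x≢y (cong (a ∷_) p)))

lookup1-zipWith : ∀ {A B C : Set} (f : A → B → C) {n} (x : Vec A n) (y : Vec B n)
  (k : ℕ) (da : A) (db : B) →
  lookup1 (zipWith f x y) k (f da db) ≡ f (lookup1 x k da) (lookup1 y k db)
lookup1-zipWith f [] [] k da db = refl
lookup1-zipWith f (a ∷ x) (b ∷ y) zero da db = refl
lookup1-zipWith f (a ∷ x) (b ∷ y) (suc zero) da db = refl
lookup1-zipWith f (a ∷ x) (b ∷ y) (suc (suc k)) da db = lookup1-zipWith f x y (suc k) da db

unorderedPair-≡ : ∀ {ℓ} (p q p' q' : Bits ℓ) → unorderedPair p q ≡ unorderedPair p' q' →
  (p ≡ p' × q ≡ q') ⊎ (p ≡ q' × q ≡ p')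
unorderedPair-≡ p q p' q' h with p <bits q | p' <bits q'
... | true  | true  = inj₁ (cong proj₁ h , cong proj₂ h)
... | true  | false = inj₂ (cong proj₁ h , cong proj₂ h)
... | false | true  = inj₂ (cong proj₂ h , cong proj₁ h)
... | false | false = inj₁ (cong proj₂ h , cong proj₁ h)

pair-partner : ∀ {ℓ} (A B C : Bits ℓ) → A ≢ B →
  unorderedPair B C ≡ unorderedPair A B → C ≡ A
pair-partner A B C A≢B h with unorderedPair-≡ B C A B h
... | inj₁ (B≡A , _) = ⊥-elim (A≢B (sym B≡A))
... | inj₂ (_ , C≡A) = C≡A

dist : ∀ {ℓ} → Bits ℓ → Bits ℓ → ℕ
dist = firstDiff _≟ᵇ_

-- If {D,E} = {A,B} and A is as far from D as from E, then A = B: one of D, E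
-- is A itself, at distance 0, so the other is at distance 0 as well.
equidistant-pair : ∀ {ℓ} (A B D E : Bits ℓ) →
  unorderedPair D E ≡ unorderedPair A B → dist A D ≡ dist A E → A ≡ B
equidistant-pair A B D E h eq with unorderedPair-≡ D E A B h
... | inj₁ (refl , refl) = firstDiff≡0⇒≡ _≟ᵇ_ A B (trans (sym eq) (firstDiff-refl _≟ᵇ_ A))
... | inj₂ (refl , refl) = firstDiff≡0⇒≡ _≟ᵇ_ A B (trans eq (firstDiff-refl _≟ᵇ_ A))

block : ∀ {ℓ} → V ℓ → ℕ → Bits ℓ
block {ℓ} x k = lookup1 x k (replicate ℓ false)

firstBlock : ∀ {ℓ} → V ℓ → V ℓ → ℕ
firstBlock = firstDiff (≡-dec _≟ᵇ_)

leadingPair-≡ : ∀ {ℓ} (x y x' y' : V ℓ) → φ x y ≡ φ x' y' →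
  let i = firstBlock x' y' in
  unorderedPair (block x i) (block y i) ≡ unorderedPair (block x' i) (block y' i)
leadingPair-≡ x y x' y' h =
  subst (λ k → unorderedPair (block x k) (block y k) ≡ proj₂ leading')
        (,-injectiveˡ leading≡) (,-injectiveʳ leading≡)
  where
  leading' = proj₁ (proj₁ (φ x' y'))
  leading≡ : proj₁ (proj₁ (φ x y)) ≡ leading'
  leading≡ = cong (λ col → proj₁ (proj₁ col)) h

blockDist-≡ : ∀ {ℓ} (x y x' y' : V ℓ) → φ x y ≡ φ x' y' → (k : ℕ) →
  dist (block x k) (block y k) ≡ dist (block x' k) (block y' k)
blockDist-≡ {ℓ} x y x' y' h k = begin
  dist (block x k) (block y k)               ≡⟨ lookup1-zipWith dist x y k d d ⟨
  lookup1 (zipWith dist x y) k (dist d d)    ≡⟨ cong (λ v → lookup1 v k (dist d d)) dists≡ ⟩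
  lookup1 (zipWith dist x' y') k (dist d d)  ≡⟨ lookup1-zipWith dist x' y' k d d ⟩
  dist (block x' k) (block y' k)             ∎
  where
  open ≡-Reasoning
  d = replicate ℓ false
  dists≡ : zipWith dist x y ≡ zipWith dist x' y'
  dists≡ = cong (λ col → proj₂ (proj₁ col)) h

lemma7 : (ℓ : ℕ) → ℓ ≥ 1 →
    ¬ (Σ[ a ∈ V ℓ ] Σ[ b ∈ V ℓ ] Σ[ c ∈ V ℓ ] Σ[ d ∈ V ℓ ] Σ[ e ∈ V ℓ ]
    Σ[ α ∈ Color ℓ ] Σ[ β ∈ Color ℓ ]
    ((a ≢ b) × (a ≢ c) × (a ≢ d) × (a ≢ e) × (b ≢ c) × (b ≢ d) × (b ≢ e)
    × (c ≢ d) × (c ≢ e) × (d ≢ e))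
    × (φ a b ≡ α) × (φ b c ≡ α) × (φ d e ≡ α)
    × (φ c d ≡ β) × (φ a e ≡ β))
lemma7 ℓ _ (a , b , c , d , e , α , β , (a≢b , _) , φab , φbc , φde , φcd , φae) =
  A≢B (equidistant-pair A B (X d) (X e) DE≡AB A-equidistant)
  where
  i = firstBlock a b
  X : V ℓ → Bits ℓ
  X x = block x i
  A = X a
  B = X b
  A≢B : A ≢ B
  A≢B = lookup1-firstDiff (≡-dec _≟ᵇ_) a b (replicate ℓ false) a≢b
  C≡A : X c ≡ A
  C≡A = pair-partner A B (X c) A≢B (leadingPair-≡ b c a b (trans φbc (sym φab)))
  DE≡AB : unorderedPair (X d) (X e) ≡ unorderedPair A B
  DE≡AB = leadingPair-≡ d e a b (trans φde (sym φab))
  A-equidistant : dist A (X d) ≡ dist A (X e)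
  A-equidistant = subst (λ Z → dist Z (X d) ≡ dist A (X e)) C≡A
                    (blockDist-≡ c d a e (trans φcd (sym φae)) i)
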